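{- Let $\phi$ be an $\mathcal{AF}^{\ell}$-sentence and suppose $\mathfrak{A}$ and $\mathfrak{A}'$ are structures interpreting the signature of $\phi$ over a common domain $A$ such that $\mathfrak{A}\approx_\ell\mathfrak{A}'$. Then $\mathfrak{A}\models\phi$ implies $\mathfrak{A}'\models\phi$.
   Context: Formulas are first-order over relational signatures with no equality, constants or function symbols. A function $f\colon[1,m]\to[1,k]$ is adjacent if $|f(i+1)-f(i)|\le1$ for $1\le i<m$; an adjacent $k$-atom is $p(x_{f(1)}\cdots x_{f(m)})$ with $p$ of arity $m$ and $f$ adjacent. $\mathcal{AF}^{[k]}$: adjacent $k$-atoms are in it, it is closed under Boolean combinations, and $\exists x_{k+1}\phi,\forall x_{k+1}\phi\in\mathcal{AF}^{[k]}$ for $\phi\in\mathcal{AF}^{[k+1]}$; $\mathcal{AF}=\bigcup_k\mathcal{AF}^{[k]}$, and $\mathcal{AF}^{\ell}$ is the set of $\mathcal{AF}$-formulas using no variables other than $x_1,\dots,x_\ell$. For words $\bar a=a_1\cdots a_k$ and $\bar c$ of length $m$ over a set $A$, $\bar a$ generates $\bar c$ if $\bar c=a_{f(1)}\cdots a_{f(m)}$ for some surjective adjacent $f\colon[1,m]\to[1,k]$. The primitive length of a word $\bar c$ is the minimum length of a word generating $\bar c$ (equivalently, the length of any word generating $\bar c$ that is not generated by any shorter word). For structures $\mathfrak{A},\mathfrak{A}'$ over a common domain $A$, $\mathfrak{A}\approx_\ell\mathfrak{A}'$ means: for every predicate $p$ (of any arity $m\ge0$) and every $m$-tuple $\bar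 a$ from $A$ of primitive length at most $\ell$, $\bar a\in p^{\mathfrak{A}}$ iff $\bar a\in p^{\mathfrak{A}'}$. -}

module Defs where

open import Data.Nat using (ℕ; zero; suc; _≤_; _<_; ∣_-_∣)
open import Data.Fin using (Fin; zero; suc; toℕ; inject₁)
open import Data.Product using (Σ; ∃; _×_; _,_)
open import Data.Sum using (_⊎_)
open import Data.Empty using (⊥)
open import Relation.Nullary using (¬_)
open import Relation.Binary.PropositionalEquality using (_≡_)

record Signature : Set₁ where
  field
    Pred  : Set
    arity : Pred → ℕ
open Signature public

record Structure (S : Signature) (A : Set) : Set₁ where
  field
    rel : (p : Pred S) → (Fin (arity S p) → A) → Set
open Structure public

Adjacent : ∀ {m k} → (Fin m → Fin k) → Set
Adjacent {m} f = (i j : Fin m) → toℕ j ≡ suc (toℕ i) → ∣ toℕ (f j) - toℕ (f i) ∣ ≤ 1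

Surj : ∀ {m k} → (Fin m → Fin k) → Set
Surj {m} {k} f = (y : Fin k) → ∃ λ (x : Fin m) → f x ≡ y

-- AF S k  is  AF^[k]: formulas whose (potentially) free variables are
-- x_1..x_k (index i : Fin k stands for x_{i+1}).
data AF (S : Signature) : ℕ → Set where
  atom : ∀ {k} (p : Pred S) (f : Fin (arity S p) → Fin k) → Adjacent f → AF S k
  ¬'   : ∀ {k} → AF S k → AF S k
  _∧'_ : ∀ {k} → AF S k → AF S k → AF S k
  _∨'_ : ∀ {k} → AF S k → AF S k → AF S k
  _⇒'_ : ∀ {k} → AF S k → AF S k → AF S k
  ∃'   : ∀ {k} → AF S (suc k) → AF S k   -- ∃ x_{k+1}
  ∀'   : ∀ {k} → AF S (suc k) → AF S k   -- ∀ x_{k+1}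

Free : ∀ {S k} → Fin k → AF S k → Set
Free i (atom p f _) = ∃ λ j → f j ≡ i
Free i (¬' φ)   = Free i φ
Free i (φ ∧' ψ) = Free i φ ⊎ Free i ψ
Free i (φ ∨' ψ) = Free i φ ⊎ Free i ψ
Free i (φ ⇒' ψ) = Free i φ ⊎ Free i ψ
Free i (∃' φ)   = Free (inject₁ i) φ
Free i (∀' φ)   = Free (inject₁ i) φ

Sentence : ∀ {S k} → AF S k → Set
Sentence {k = k} φ = (i : Fin k) → ¬ Free i φ

UsesVarsBelow : ∀ {S k} → ℕ → AF S k → Set
UsesVarsBelow ℓ (atom p f _) = ∀ j → toℕ (f j) < ℓ
UsesVarsBelow ℓ (¬' φ)   = UsesVarsBelow ℓ φ
UsesVarsBelow ℓ (φ ∧' ψ) = UsesVarsBelow ℓ φ × UsesVarsBelow ℓ ψ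
UsesVarsBelow ℓ (φ ∨' ψ) = UsesVarsBelow ℓ φ × UsesVarsBelow ℓ ψ
UsesVarsBelow ℓ (φ ⇒' ψ) = UsesVarsBelow ℓ φ × UsesVarsBelow ℓ ψ
UsesVarsBelow ℓ (∃' {k} φ) = (k < ℓ) × UsesVarsBelow ℓ φ
UsesVarsBelow ℓ (∀' {k} φ) = (k < ℓ) × UsesVarsBelow ℓ φ

AFℓSentence : ∀ {S k} → ℕ → AF S k → Set
AFℓSentence ℓ φ = Sentence φ × UsesVarsBelow ℓ φ

snoc : ∀ {A : Set} {k} → (Fin k → A) → A → Fin (suc k) → A
snoc {k = zero}  ρ a zero    = a
snoc {k = suc k} ρ a zero    = ρ zero
snoc {k = suc k} ρ a (suc i) = snoc (λ j → ρ (suc j)) a i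

⟦_⟧ : ∀ {S A k} → AF S k → Structure S A → (Fin k → A) → Set
⟦ atom p f _ ⟧ 𝔄 ρ = rel 𝔄 p (λ j → ρ (f j))
⟦ ¬' φ ⟧   𝔄 ρ = ¬ ⟦ φ ⟧ 𝔄 ρ
⟦ φ ∧' ψ ⟧ 𝔄 ρ = ⟦ φ ⟧ 𝔄 ρ × ⟦ ψ ⟧ 𝔄 ρ
⟦ φ ∨' ψ ⟧ 𝔄 ρ = ⟦ φ ⟧ 𝔄 ρ ⊎ ⟦ ψ ⟧ 𝔄 ρ
⟦ φ ⇒' ψ ⟧ 𝔄 ρ = ⟦ φ ⟧ 𝔄 ρ → ⟦ ψ ⟧ 𝔄 ρ
⟦_⟧ {A = A} (∃' φ) 𝔄 ρ = Σ A λ a → ⟦ φ ⟧ 𝔄 (snoc ρ a)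
⟦_⟧ {A = A} (∀' φ) 𝔄 ρ = (a : A) → ⟦ φ ⟧ 𝔄 (snoc ρ a)

-- 𝔄 ⊨ φ for a sentence φ (truth does not depend on the assignment).
_⊨_ : ∀ {S A k} → Structure S A → AF S k → Set
_⊨_ {A = A} {k = k} 𝔄 φ = (ρ : Fin k → A) → ⟦ φ ⟧ 𝔄 ρ

Generates : ∀ {A : Set} {k m} → (Fin k → A) → (Fin m → A) → Set
Generates {k = k} {m} a c =
  Σ (Fin m → Fin k) λ f → Surj f × Adjacent f × ((j : Fin m) → c j ≡ a (f j))

-- primitive length of c is at most ℓ  (the minimum length of a generating
-- word is ≤ ℓ  iff  some word of length ≤ ℓ generates c).
PrimLen≤ : ∀ {A : Set} {m} → (Fin m → A) → ℕ → Set
PrimLen≤ {A} c ℓ = Σ ℕ λ k → (k ≤ ℓ) × Σ (Fin k → A) λ a → Generates a c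

_≈[_]_ : ∀ {S A} → Structure S A → ℕ → Structure S A → Set
_≈[_]_ {S} {A} 𝔄 ℓ 𝔄' =
  (p : Pred S) (c : Fin (arity S p) → A) → PrimLen≤ c ℓ →
  (rel 𝔄 p c → rel 𝔄' p c) × (rel 𝔄' p c → rel 𝔄 p c)

-- The key observation is that an adjacent atom over x_1 … x_ℓ, instantiated by any
-- assignment, yields a tuple of primitive length at most ℓ: an adjacent index map
-- takes every value between its least value lo and its greatest value hi (a discrete
-- intermediate value theorem), so after shifting by lo it maps surjectively and
-- adjacently onto a window of hi − lo + 1 ≤ ℓ positions. Hence ≈ℓ-equivalent
-- structures agree on all atoms of an AF^ℓ-formula, and truth is transferred by
-- induction on the formula, using that ≈ℓ is symmetric for the contravariant positions.
module Submission where

open import Defs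
open import Data.Nat using (ℕ; zero; suc; _+_; _∸_; _≤_; _<_; ∣_-_∣; z≤n; s≤s; s≤s⁻¹; _≤?_)
open import Data.Nat.Properties
open import Data.Fin using (Fin; zero; suc; toℕ; fromℕ<)
open import Data.Fin.Properties using (toℕ-injective; toℕ<n; toℕ-fromℕ<)
open import Data.List.Base using (allFin)
open import Data.List.Extrema ≤-totalOrder using (argmin; argmax; f[argmin]≤f[xs]; f[xs]≤f[argmax])
open import Data.List.Membership.Propositional.Properties using (∈-allFin)
open import Data.List.Relation.Unary.All as All using ()
open import Data.Product as Product using (Σ; ∃; _×_; _,_; proj₁; proj₂; swap)
open import Data.Sum as Sum using (_⊎_; inj₁; inj₂)
open import Function using (_∘_; id)
open import Relation.Nullary using (yes; no)
open import Relation.Binary.PropositionalEquality using (_≡_; refl; sym; trans; cong; cong₂; subst; module ≡-Reasoning)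

private
  variable
    a b c t m k ℓ : ℕ

∣m-n∣≤1⇒m≤1+n : ∣ a - b ∣ ≤ 1 → a ≤ suc b
∣m-n∣≤1⇒m≤1+n {a} {b} d = ≤-trans (m≤∣m-n∣+n a b) (+-monoˡ-≤ b d)

Between : ℕ → ℕ → ℕ → Set
Between a c t = (a ≤ t × t ≤ c) ⊎ (c ≤ t × t ≤ a)

Between-refl⇒≡ : Between a a t → a ≡ t
Between-refl⇒≡ (inj₁ (a≤t , t≤a)) = ≤-antisym a≤t t≤a
Between-refl⇒≡ (inj₂ (a≤t , t≤a)) = ≤-antisym a≤t t≤a

Between-step : ∣ b - a ∣ ≤ 1 → Between a c t → a ≡ t ⊎ Between b c t
Between-step {b} {t = t} d (inj₁ (a≤t , t≤c)) with b ≤? t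
... | yes b≤t = inj₂ (inj₁ (b≤t , t≤c))
... | no b≰t  = inj₁ (≤-antisym a≤t (s≤s⁻¹ (≤-trans (≰⇒> b≰t) (∣m-n∣≤1⇒m≤1+n d))))
Between-step {b} {a} {t = t} d (inj₂ (c≤t , t≤a)) with t ≤? b
... | yes t≤b = inj₂ (inj₂ (c≤t , t≤b))
... | no t≰b  = inj₁ (≤-antisym (≤-trans (∣m-n∣≤1⇒m≤1+n (subst (_≤ 1) (∣-∣-comm b a) d)) (≰⇒> t≰b)) t≤a)

AdjacentSteps : (Fin m → ℕ) → Set
AdjacentSteps h = ∀ i j → toℕ j ≡ suc (toℕ i) → ∣ h j - h i ∣ ≤ 1

intermediate-value : (h : Fin (suc m) → ℕ) → AdjacentSteps h →
                     ∀ j → Between (h zero) (h j) t → ∃ λ i → h i ≡ t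
intermediate-value h adj zero between = zero , Between-refl⇒≡ between
intermediate-value {suc m} h adj (suc j) between
  with Between-step (adj zero (suc zero) refl) between
... | inj₁ h₀≡t     = zero , h₀≡t
... | inj₂ between′ = Product.map suc id
  (intermediate-value (h ∘ suc) (λ i j e → adj (suc i) (suc j) (cong suc e)) j between′)

interval-image : (h : Fin (suc m) → ℕ) → AdjacentSteps h →
                 ∀ jₗ jₕ → h jₗ ≤ t → t ≤ h jₕ → ∃ λ i → h i ≡ t
interval-image {t = t} h adj jₗ jₕ lo≤t t≤hi with t ≤? h zero
... | yes t≤h₀ = intermediate-value h adj jₗ (inj₂ (lo≤t , t≤h₀))
... | no t≰h₀  = intermediate-value h adj jₕ (inj₁ (<⇒≤ (≰⇒> t≰h₀) , t≤hi))

lowest : (h : Fin (suc m) → ℕ) → Σ (Fin (suc m)) λ j → ∀ i → h j ≤ h i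
lowest h = argmin h zero (allFin _) , All.lookup (f[argmin]≤f[xs] {f = h} zero (allFin _)) ∘ ∈-allFin

highest : (h : Fin (suc m) → ℕ) → Σ (Fin (suc m)) λ j → ∀ i → h i ≤ h j
highest h = argmax h zero (allFin _) , All.lookup (f[xs]≤f[argmax] {f = h} zero (allFin _)) ∘ ∈-allFin

module AdjacentWindow (f : Fin (suc m) → Fin k) (adj : Adjacent f) where

  jₗ jₕ : Fin (suc m)
  jₗ = proj₁ (lowest (toℕ ∘ f))
  jₕ = proj₁ (highest (toℕ ∘ f))

  lo hi width : ℕ
  lo    = toℕ (f jₗ)
  hi    = toℕ (f jₕ)
  width = suc (hi ∸ lo)

  lo≤ : ∀ j → lo ≤ toℕ (f j)
  lo≤ = proj₂ (lowest (toℕ ∘ f))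

  ≤hi : ∀ j → toℕ (f j) ≤ hi
  ≤hi = proj₂ (highest (toℕ ∘ f))

  width≤ : width ≤ suc hi
  width≤ = s≤s (m∸n≤m hi lo)

  offset : Fin (suc m) → Fin width
  offset j = fromℕ< (s≤s (∸-monoˡ-≤ lo (≤hi j)))

  lo+offset : ∀ j → lo + toℕ (offset j) ≡ toℕ (f j)
  lo+offset j = trans (cong (lo +_) (toℕ-fromℕ< _)) (m+[n∸m]≡n (lo≤ j))

  lo+i≤hi : (i : Fin width) → lo + toℕ i ≤ hi
  lo+i≤hi i = ≤-trans (+-monoʳ-≤ lo (s≤s⁻¹ (toℕ<n i))) (≤-reflexive (m+[n∸m]≡n (lo≤ jₕ)))

  position : Fin width → Fin k
  position i = fromℕ< (≤-trans (s≤s (lo+i≤hi i)) (toℕ<n (f jₕ)))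

  position-offset : ∀ j → position (offset j) ≡ f j
  position-offset j = toℕ-injective (trans (toℕ-fromℕ< _) (lo+offset j))

  offset-adjacent : Adjacent offset
  offset-adjacent i j e = subst (_≤ 1) shifted (adj i j e)
    where
    open ≡-Reasoning
    shifted : ∣ toℕ (f j) - toℕ (f i) ∣ ≡ ∣ toℕ (offset j) - toℕ (offset i) ∣
    shifted = begin
      ∣ toℕ (f j) - toℕ (f i) ∣                      ≡⟨ sym (cong₂ ∣_-_∣ (lo+offset j) (lo+offset i)) ⟩
      ∣ lo + toℕ (offset j) - lo + toℕ (offset i) ∣  ≡⟨ ∣m+n-m+o∣≡∣n-o∣ lo _ _ ⟩
      ∣ toℕ (offset j) - toℕ (offset i) ∣            ∎

  offset-surjective : Surj offset
  offset-surjective y =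
    Product.map₂ lands (interval-image (toℕ ∘ f) adj jₗ jₕ (m≤m+n lo (toℕ y)) (lo+i≤hi y))
    where
    lands : ∀ {j} → toℕ (f j) ≡ lo + toℕ y → offset j ≡ y
    lands {j} e = toℕ-injective (+-cancelˡ-≡ lo _ _ (trans (lo+offset j) e))

  generates : {A : Set} (ρ : Fin k → A) → Generates (ρ ∘ position) (ρ ∘ f)
  generates ρ = offset , offset-surjective , offset-adjacent , cong ρ ∘ sym ∘ position-offset

adjacent-primLen≤ : {A : Set} (f : Fin m → Fin k) → Adjacent f → (∀ j → toℕ (f j) < ℓ) →
                    (ρ : Fin k → A) → PrimLen≤ (ρ ∘ f) ℓ
adjacent-primLen≤ {zero}  f adj bound ρ = 0 , z≤n , (λ ()) , (λ ()) , (λ ()) , (λ ()) , (λ ())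
adjacent-primLen≤ {suc m} f adj bound ρ =
  width , ≤-trans width≤ (bound jₕ) , ρ ∘ position , generates ρ
  where open AdjacentWindow f adj

module _ {S : Signature} {A : Set} where

  ≈-sym : {𝔄 𝔄′ : Structure S A} → 𝔄 ≈[ ℓ ] 𝔄′ → 𝔄′ ≈[ ℓ ] 𝔄
  ≈-sym E p c prim = swap (E p c prim)

  ≈-preserves : {𝔄 𝔄′ : Structure S A} → 𝔄 ≈[ ℓ ] 𝔄′ →
                (φ : AF S k) → UsesVarsBelow ℓ φ → (ρ : Fin k → A) → ⟦ φ ⟧ 𝔄 ρ → ⟦ φ ⟧ 𝔄′ ρ
  ≈-preserves E (atom p f adj) bound ρ = proj₁ (E p _ (adjacent-primLen≤ f adj bound ρ))
  ≈-preserves E (¬' φ) u ρ ¬φ = ¬φ ∘ ≈-preserves (≈-sym E) φ u ρ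
  ≈-preserves E (φ ∧' ψ) (u , v) ρ = Product.map (≈-preserves E φ u ρ) (≈-preserves E ψ v ρ)
  ≈-preserves E (φ ∨' ψ) (u , v) ρ = Sum.map (≈-preserves E φ u ρ) (≈-preserves E ψ v ρ)
  ≈-preserves E (φ ⇒' ψ) (u , v) ρ φ⇒ψ = ≈-preserves E ψ v ρ ∘ φ⇒ψ ∘ ≈-preserves (≈-sym E) φ u ρ
  ≈-preserves E (∃' φ) (_ , u) ρ (a , φa) = a , ≈-preserves E φ u _ φa
  ≈-preserves E (∀' φ) (_ , u) ρ ∀φ a = ≈-preserves E φ u _ (∀φ a)

lemma6 : (S : Signature) (A : Set) (ℓ k : ℕ) (φ : AF S k) → AFℓSentence ℓ φ → (𝔄 𝔄' : Structure S A) → 𝔄 ≈[ ℓ ] 𝔄' → 𝔄 ⊨ φ → 𝔄' ⊨ φ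
lemma6 S A ℓ k φ (_ , bound) 𝔄 𝔄' E 𝔄⊨φ ρ = ≈-preserves E φ bound ρ (𝔄⊨φ ρ)
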